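{- In the theory $\mathsf{ATC}$ extended by the definition $Pxy \leftrightarrow \mathfrak{at}_{x}\preccurlyeq \mathfrak{at}_{y}$, with $Oxy:=\exists z(Pzx\land Pzy)$, the strong supplementation principle $\neg Pxy \to \exists z(Pzx\land \neg Ozy)$ is provable.
   Context: Language: two-sorted classical logic with individual variables $x,y,z,\dots$ and plural variables $xx,yy,zz,\dots$; identity $=$ between individual terms; the predicate $x\prec tt$ ("$x$ is one of $tt$") with an individual term on the left and a plural term on the right. Abbreviations: $tt\preccurlyeq ss := \forall z(z\prec tt\to z\prec ss)\land \exists x(x\prec tt)$; $tt\approx ss := \forall x(x\prec tt\leftrightarrow x\prec ss)$; restricted quantifiers $\forall_{z\prec tt}\varphi:=\forall z(z\prec tt\to\varphi)$, $\exists_{z\prec tt}\varphi:=\exists z(z\prec tt\land\varphi)$, $\forall_{yy\preccurlyeq tt}\varphi:=\forall yy(yy\preccurlyeq tt\to\varphi)$, $\exists_{yy\preccurlyeq tt}\varphi:=\exists yy(yy\preccurlyeq tt\land\varphi)$. No plural comprehension schema is assumed and plurals may be empty. The theory $\mathsf{ATC}$ has a single non-logical primitive $F$, written $F_{tt}x$ ("$x$ is a composition of $tt$"), with $tt$ a plural term and $x$ individual. Plural terms: plural variables, a constant $aa$, and $\mathfrak{at}_{tt}$ for plural terms $tt$. Axioms of $\mathsf{ATC}$ (universally closed): (Df.$aa_F$) $x\prec aa\leftrightarrow \forall yy\,\forall_{z\prec yy}(F_{yy}x\to z=x)$; (Df.$\mathfrak{at}^{pl}_F$) $x\prec \mathfrak{at}_{zz}\leftrightarrow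 \exists_{y\prec zz}\exists_{yy\preccurlyeq aa}(F_{yy}y\land x\prec yy)$; (ATC1) $\forall x\,\exists_{zz\preccurlyeq aa}\big(F_{zz}x\land \forall_{yy\preccurlyeq aa}(F_{yy}x\leftrightarrow zz\approx yy)\land\forall y(F_{zz}y\to x=y)\big)$; (ATC2) $F_{zz}x\leftrightarrow F_{\mathfrak{at}_{zz}}x$. Since by (ATC1) each $x$ determines a unique such plurality, $\mathsf{ATC}$ is extended by a plural term $\mathfrak{at}_x$ for each individual term $x$, characterized by $\mathfrak{at}_{x}\preccurlyeq aa \land F_{\mathfrak{at}_{x}}x \land \forall_{yy\preccurlyeq aa}(F_{yy}x\leftrightarrow yy\approx\mathfrak{at}_{x})\land \forall y (F_{\mathfrak{at}_{x}}y\to x=y)$. -}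

module Defs where

open import Data.Product using (Σ; ∃; _×_; _,_)
open import Relation.Nullary using (¬_)
open import Relation.Binary.PropositionalEquality using (_≡_)
open import Function.Bundles using (_⇔_)

-- A (Henkin-style, two-sorted) structure for the language of ATC, extended
-- by the plural term 𝔞𝔱_x for individual terms x.  Since no plural
-- comprehension is assumed, plurals form a second sort PL with the
-- primitive relation _≺_ ("is one of"); plurals may be empty.
record ATC : Set₁ where
  infix 4 _≺_ _≼_ _≈ₚ_
  field
    D    : Set
    PL   : Set
    _≺_  : D → PL → Set
    F    : PL → D → Set        -- F tt x : x is a composition of tt
    aa   : PL
    atP  : PL → PL
    atI  : D → PL

  _≼_ : PL → PL → Set
  tt ≼ ss = (∀ z → z ≺ tt → z ≺ ss) × ∃ λ x → x ≺ tt

  _≈ₚ_ : PL → PL → Set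
  tt ≈ₚ ss = ∀ x → (x ≺ tt ⇔ x ≺ ss)

  field
    Df-aa : ∀ x → (x ≺ aa ⇔ (∀ yy → ∀ z → z ≺ yy → F yy x → z ≡ x))
    Df-at : ∀ zz x →
      (x ≺ atP zz ⇔ (∃ λ y → y ≺ zz × (∃ λ yy → yy ≼ aa × (F yy y × x ≺ yy))))
    ATC1 : ∀ x → ∃ λ zz → zz ≼ aa × F zz x
             × (∀ yy → yy ≼ aa → (F yy x ⇔ zz ≈ₚ yy))
             × (∀ y → F zz y → x ≡ y)
    ATC2 : ∀ zz x → (F zz x ⇔ F (atP zz) x)
    Df-atI : ∀ x → atI x ≼ aa × F (atI x) x
             × (∀ yy → yy ≼ aa → (F yy x ⇔ yy ≈ₚ atI x))
             × (∀ y → F (atI x) y → x ≡ y)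

  P : D → D → Set
  P x y = atI x ≼ atI y

  O : D → D → Set
  O x y = ∃ λ z → P z x × P z y

-- If x is not a part of y, some atom a among the atoms of x is not among the
-- atoms of y.  The atoms of an atom are just itself, so a is a part of x, and
-- any common part of a and y would have a nonempty plurality of atoms made of
-- a alone and contained in the atoms of y, putting a among them.
module Submission where

open import Defs
open import Data.Product using (∃; _×_; _,_; proj₁; proj₂)
open import Relation.Nullary using (¬_)
open import Axiom.ExcludedMiddle using (ExcludedMiddle)
open import Axiom.DoubleNegationElimination using (em⇒dne)
open import Level using (0ℓ)
open import Function.Bundles using (Equivalence)
open import Relation.Binary.PropositionalEquality using (_≡_; sym; subst)

¬⊆⇒∃∈∖ : ExcludedMiddle 0ℓ → {A : Set} {Q R : A → Set} →
         ¬ (∀ z → Q z → R z) → ∃ λ z → Q z × ¬ R z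
¬⊆⇒∃∈∖ em ¬Q⊆R =
  dne λ ¬∃ → ¬Q⊆R λ z Qz → dne λ ¬Rz → ¬∃ (z , Qz , ¬Rz)
  where dne = em⇒dne em

module _ (M : ATC) where
  open ATC M

  atI-nonempty : ∀ w → ∃ λ u → u ≺ atI w
  atI-nonempty w = proj₂ (proj₁ (Df-atI w))

  atI⊆aa : ∀ w z → z ≺ atI w → z ≺ aa
  atI⊆aa w = proj₁ (proj₁ (Df-atI w))

  atI-atom : ∀ {a z} → a ≺ aa → z ≺ atI a → z ≡ a
  atI-atom {a} {z} a∈aa z∈a =
    Equivalence.to (Df-aa a) a∈aa (atI a) z z∈a (proj₁ (proj₂ (Df-atI a)))

  atom-part : ∀ {a x} → a ≺ aa → a ≺ atI x → P a x
  atom-part {a} {x} a∈aa a∈x =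
    (λ z z∈a → subst (_≺ atI x) (sym (atI-atom a∈aa z∈a)) a∈x) , atI-nonempty a

  atom-overlap : ∀ {a y} → a ≺ aa → O a y → a ≺ atI y
  atom-overlap a∈aa (w , (w⊆a , _) , (w⊆y , _)) =
    let u , u∈w = atI-nonempty w
    in subst (_≺ atI _) (atI-atom a∈aa (w⊆a u u∈w)) (w⊆y u u∈w)

lemma2 : ExcludedMiddle 0ℓ → (M : ATC) → let open ATC M in
    ∀ x y → ¬ P x y → ∃ λ z → P z x × ¬ O z y
lemma2 em M x y ¬Pxy
  with ¬⊆⇒∃∈∖ em (λ x⊆y → ¬Pxy (x⊆y , atI-nonempty M x))
... | a , a∈x , a∉y =
  a , atom-part M a∈aa a∈x , λ Oay → a∉y (atom-overlap M a∈aa Oay)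
  where
  open ATC M
  a∈aa : a ≺ aa
  a∈aa = atI⊆aa M x a a∈x
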